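{- Let $L\ge1$, $J\ge0$ be integers and let $Q_{\ell,j}(x)$, $0\le\ell\le L$, $0\le j\le J$, be polynomials with nonnegative coefficients. With the allowed weighted lattice paths defined from these polynomials (see context), set, for $k\ge0$, \[ F_{k,0}(x)=\sum_{n\ge0}\ \sum_{p}\ w(p)\,x^n, \] where the inner sum runs over the multiset of allowed paths from $(0,k)$ to $(n,0)$, and set $F(x,u)=\sum_{k\ge0}F_{k,0}(x)u^k$. Then $F(x,u)$ satisfies \[ F(x,u)=1+x\sum_{\ell=0}^L\sum_{j=0}^J Q_{\ell,j}(x)\,u^j\,\Delta^\ell F(x,u), \] and it is the unique power series solution of this equation.
   Context: For $G(x,u)=\sum_{k\ge0}G_k(x)u^k$ and $\ell\ge1$, $\Delta^\ell G(x,u)=\sum_{k\ge0}G_{k+\ell}(x)u^k$, and $\Delta^0G=G$. Steps and paths: for each level $h\ge0$, the multiset $\mathcal S_h$ of allowed steps at level $h$ contains, for each triple $(\ell,j,r)$ with $0\le\ell\le L$, $0\le j\le\min(h,J)$, $r\ge0$ and $[x^r]Q_{\ell,j}(x)\ne0$, one copy of the step $(1+r,\ell-j)$ carrying weight $[x^r]Q_{\ell,j}(x)$ (different triples give different copies, even when the vectors coincide). An allowed path from $(0,a)$ to $(n,b)$ is a sequence $p=s_1\cdots s_M$ ($M\ge0$) of step copies such that, writing $h_0=a$ and $h_m$ for the height after the first $m$ steps, each $s_m$ is a copy from $\mathcal S_{h_{m-1}}$, $h_M=b$, and the horizontal components sum to $n$ (heights then automatically stay $\ge0$). Its weight is $w(p)=\prod_{m=1}^M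 w(s_m)$; the empty path ($M=0$) is an allowed path from $(0,a)$ to $(0,a)$ of weight $1$.
   Formalization: The coefficients of the polynomials $Q_{\ell,j}(x)$ are nonnegative rationals, and uniqueness is asserted only among power series with rational coefficients. -}

module Defs where

open import Data.Nat as ℕ using (ℕ; zero; suc; _∸_)
import Data.Nat.Properties as ℕP
open import Data.Rational using (ℚ; 0ℚ; 1ℚ; _+_; _*_)
open import Data.Rational.Properties using (_≟_)
open import Data.List using (List; []; _∷_; map; concatMap; upTo; filter; foldr)
open import Data.Product using (_×_; _,_)
open import Relation.Binary.PropositionalEquality using (_≡_; _≢_; refl; sym; trans; cong)
open import Relation.Nullary using (Dec; yes; no; ¬_)

-- Polynomials with rational coefficients, as coefficient lists
-- (constant term first).  [x^r] p = coeff p r.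

Poly : Set
Poly = List ℚ

coeff : Poly → ℕ → ℚ
coeff []       r       = 0ℚ
coeff (c ∷ cs) zero    = c
coeff (c ∷ cs) (suc r) = coeff cs r

Σ< : ℕ → (ℕ → ℚ) → ℚ
Σ< n f = foldr _+_ 0ℚ (map f (upTo n))

-- Step copies and allowed paths.
-- A step copy is the triple (ℓ , j , r); it is the step (1+r , ℓ-j)
-- with weight [x^r] Q ℓ j.  A path is a list of step copies.

Triple : Set
Triple = ℕ × ℕ × ℕ

data Allowed (L J : ℕ) (Q : ℕ → ℕ → Poly) : ℕ → List Triple → ℕ → ℕ → Set where
  stop : ∀ {h n b} → n ≡ 0 → h ≡ b → Allowed L J Q h [] n b
  step : ∀ {h ℓ j r p n m b} →
         ℓ ℕ.≤ L → j ℕ.≤ h → j ℕ.≤ J → coeff (Q ℓ j) r ≢ 0ℚ →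
         n ≡ suc r ℕ.+ m →
         Allowed L J Q (h ∸ j ℕ.+ ℓ) p m b →
         Allowed L J Q h ((ℓ , j , r) ∷ p) n b

allowed? : ∀ L J Q h p n b → Dec (Allowed L J Q h p n b)
allowed? L J Q h [] n b with n ℕ.≟ 0 | h ℕ.≟ b
... | yes e1 | yes e2 = yes (stop e1 e2)
... | no ne  | _      = no λ { (stop e1 _) → ne e1 }
... | _      | no ne  = no λ { (stop _ e2) → ne e2 }
allowed? L J Q h ((ℓ , j , r) ∷ p) n b
  with ℓ ℕ.≤? L | j ℕ.≤? h | j ℕ.≤? J | coeff (Q ℓ j) r ≟ 0ℚ | suc r ℕ.≤? n
... | no ¬a | _ | _ | _ | _ = no λ { (step a _ _ _ _ _) → ¬a a }
... | yes _ | no ¬a | _ | _ | _ = no λ { (step _ a _ _ _ _) → ¬a a }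
... | yes _ | yes _ | no ¬a | _ | _ = no λ { (step _ _ a _ _ _) → ¬a a }
... | yes _ | yes _ | yes _ | yes z | _ = no λ { (step _ _ _ nz _ _) → nz z }
... | yes _ | yes _ | yes _ | no _ | no ¬le =
      no λ { (step _ _ _ _ e _) → ¬le (ℕP.≤-trans (ℕP.m≤m+n (suc r) _) (ℕP.≤-reflexive (sym e))) }
... | yes a | yes b' | yes c | no d | yes le
  with allowed? L J Q (h ∸ j ℕ.+ ℓ) p (n ∸ suc r) b
...   | yes rest = yes (step a b' c d (sym (ℕP.m+[n∸m]≡n le)) rest)
...   | no ¬rest = no λ { (step _ _ _ _ e rest) → ¬rest (subst' e rest) }
  where
  subst' : ∀ {m} → n ≡ suc r ℕ.+ m → Allowed L J Q (h ∸ j ℕ.+ ℓ) p m b →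
           Allowed L J Q (h ∸ j ℕ.+ ℓ) p (n ∸ suc r) b
  subst' {m} e x rewrite e | ℕP.m+n∸m≡n (suc r) m = x

weight : (Q : ℕ → ℕ → Poly) → List Triple → ℚ
weight Q []                  = 1ℚ
weight Q ((ℓ , j , r) ∷ p)   = coeff (Q ℓ j) r * weight Q p

seqs : {A : Set} → ℕ → List A → List (List A)
seqs zero    xs = [] ∷ []
seqs (suc m) xs = concatMap (λ x → map (x ∷_) (seqs m xs)) xs

triples : ℕ → ℕ → ℕ → List Triple
triples L J n =
  concatMap (λ ℓ → concatMap (λ j → map (λ r → (ℓ , j , r)) (upTo n)) (upTo (suc J))) (upTo (suc L))

-- Candidate paths of horizontal length n: every allowed path with
-- horizontal length n has at most n steps, each with r < n, so it
-- occurs (exactly once) in this list.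
candidates : ℕ → ℕ → ℕ → List (List Triple)
candidates L J n = concatMap (λ m → seqs m (triples L J n)) (upTo (suc n))

Fcoeff : (L J : ℕ) (Q : ℕ → ℕ → Poly) → ℕ → ℕ → ℚ
Fcoeff L J Q k n =
  foldr _+_ 0ℚ (map (weight Q) (filter (λ p → allowed? L J Q k p n 0) (candidates L J n)))

-- Formal power series in x and u over ℚ:  G k n = [u^k x^n] G(x,u).

PS : Set
PS = ℕ → ℕ → ℚ

F : (L J : ℕ) (Q : ℕ → ℕ → Poly) → PS
F L J Q k n = Fcoeff L J Q k n

onePS : PS
onePS zero zero = 1ℚ
onePS _    _    = 0ℚ

xPS : PS
xPS zero (suc zero) = 1ℚ
xPS _    _          = 0ℚ

uPow : ℕ → PS
uPow j k zero with j ℕ.≟ k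
... | yes _ = 1ℚ
... | no  _ = 0ℚ
uPow j k (suc n) = 0ℚ

polyPS : Poly → PS
polyPS q zero    n = coeff q n
polyPS q (suc k) n = 0ℚ

_⊕_ : PS → PS → PS
(f ⊕ g) k n = f k n + g k n

_⊛_ : PS → PS → PS
(f ⊛ g) k n = Σ< (suc k) (λ a → Σ< (suc n) (λ c → f a c * g (k ∸ a) (n ∸ c)))

Δ^ : ℕ → PS → PS
Δ^ ℓ G k n = G (k ℕ.+ ℓ) n

ΣPS : ℕ → (ℕ → PS) → PS
ΣPS m f k n = Σ< m (λ i → f i k n)

RHS : (L J : ℕ) (Q : ℕ → ℕ → Poly) → PS → PS
RHS L J Q G =
  onePS ⊕ (xPS ⊛ ΣPS (suc L) (λ ℓ → ΣPS (suc J) (λ j →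
             (polyPS (Q ℓ j) ⊛ uPow j) ⊛ Δ^ ℓ G)))

Solves : (L J : ℕ) (Q : ℕ → ℕ → Poly) → PS → Set
Solves L J Q G = ∀ k n → G k n ≡ RHS L J Q G k n

{-# OPTIONS --safe #-}
module Submission where

-- Cutting an allowed path after its first step (ℓ, j, r), which is possible at height k exactly
-- when j ≤ k, gives F = 1 + firstStep F coefficientwise, and firstStep G is precisely the
-- coefficient of u^k x^n in x Σ_{ℓ,j} Q_{ℓ,j}(x) u^j Δ^ℓ G(x,u). The finite enumeration that
-- defines F is handled by grouping paths by their number m of steps: the m-step paths have
-- total weight firstStep^m 1, which vanishes in x-degree below m. Since firstStep G in degree n
-- only involves G in degrees below n, a solution is determined degree by degree.

open import Defs
open import Algebra.Bundles using (Ring)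
open import Data.Empty using (⊥-elim)
open import Data.Fin using (toℕ)
open import Data.Fin.Properties using (toℕ<n)
open import Data.List using (List; []; _∷_; map; foldr; filter; concatMap; applyUpTo; upTo; _++_)
import Data.List.Properties as ListP
open import Data.List.Relation.Unary.All using (All)
open import Data.Nat as ℕ using (ℕ; zero; suc; _∸_; _≤_; _<_; z≤n; s≤s; _≟_; _≤?_; _<?_)
open import Data.Nat.Induction using (<-rec)
import Data.Nat.Properties as ℕP
open import Data.Product using (_×_; _,_; proj₁; proj₂; uncurry)
open import Data.Rational using (ℚ; 0ℚ; 1ℚ; _+_; _*_) renaming (_≤_ to _≤ℚ_)
import Data.Rational.Properties as ℚP
open import Function using (_∘_; id)
open import Relation.Binary.PropositionalEquality
  using (_≡_; _≢_; refl; sym; trans; cong; cong₂; subst; module ≡-Reasoning)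
open import Relation.Nullary using (Dec; yes; no; ¬_)
open import Relation.Nullary.Decidable using (_×-dec_; ¬?)
open import Relation.Unary using (Decidable)

open import Algebra.Properties.Semiring.Sum (Ring.semiring ℚP.+-*-ring) as Fin∑ using ()

open ≡-Reasoning

private
  variable
    A B : Set

when : {P : Set} → Dec P → ℚ → ℚ
when (yes _) x = x
when (no _)  _ = 0ℚ

module _ {P : Set} where

  when-yes : (d : Dec P) {x : ℚ} → P → when d x ≡ x
  when-yes (yes _) _ = refl
  when-yes (no ¬p) p = ⊥-elim (¬p p)

  when-no : (d : Dec P) {x : ℚ} → ¬ P → when d x ≡ 0ℚ
  when-no (yes p) ¬p = ⊥-elim (¬p p)
  when-no (no _)  _  = refl

  when-0 : (d : Dec P) → when d 0ℚ ≡ 0ℚ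
  when-0 (yes _) = refl
  when-0 (no _)  = refl

  when-cong : (d : Dec P) {x y : ℚ} → (P → x ≡ y) → when d x ≡ when d y
  when-cong (yes p) x≡y = x≡y p
  when-cong (no _)  _   = refl

  when-* : (d : Dec P) (x y : ℚ) → when d x * y ≡ when d (x * y)
  when-* (yes _) x y = refl
  when-* (no _)  x y = ℚP.*-zeroˡ y

  when-⇔ : {P′ : Set} (d : Dec P) (d′ : Dec P′) {x : ℚ} →
           (P → P′) → (P′ → P) → when d x ≡ when d′ x
  when-⇔ (yes _) (yes _)  _ _ = refl
  when-⇔ (yes p) (no ¬p′) f _ = ⊥-elim (¬p′ (f p))
  when-⇔ (no ¬p) (yes p′) _ g = ⊥-elim (¬p (g p′))
  when-⇔ (no _)  (no _)   _ _ = refl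

  when-× : {P′ : Set} (d : Dec P) (d′ : Dec P′) (x y : ℚ) →
           when (d ×-dec d′) (x * y) ≡ when d (x * when d′ y)
  when-× (yes _) (yes _) x y = refl
  when-× (yes _) (no _)  x y = sym (ℚP.*-zeroʳ x)
  when-× (no _)  _       x y = refl

sumMap : (A → ℚ) → List A → ℚ
sumMap f xs = foldr _+_ 0ℚ (map f xs)

sumMap-++ : (f : A → ℚ) (xs ys : List A) → sumMap f (xs ++ ys) ≡ sumMap f xs + sumMap f ys
sumMap-++ f []       ys = sym (ℚP.+-identityˡ _)
sumMap-++ f (x ∷ xs) ys = trans (cong (f x +_) (sumMap-++ f xs ys)) (sym (ℚP.+-assoc (f x) _ _))

sumMap-cong : {f g : A → ℚ} → (∀ x → f x ≡ g x) → (xs : List A) → sumMap f xs ≡ sumMap g xs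
sumMap-cong f≗g []       = refl
sumMap-cong f≗g (x ∷ xs) = cong₂ _+_ (f≗g x) (sumMap-cong f≗g xs)

sumMap-*ˡ : (c : ℚ) (f : A → ℚ) (xs : List A) → sumMap (λ x → c * f x) xs ≡ c * sumMap f xs
sumMap-*ˡ c f []       = sym (ℚP.*-zeroʳ c)
sumMap-*ˡ c f (x ∷ xs) = trans (cong (c * f x +_) (sumMap-*ˡ c f xs)) (sym (ℚP.*-distribˡ-+ c (f x) _))

sumMap-filter : {P : A → Set} (P? : Decidable P) (f : A → ℚ) (xs : List A) →
                sumMap f (filter P? xs) ≡ sumMap (λ x → when (P? x) (f x)) xs
sumMap-filter P? f [] = refl
sumMap-filter P? f (x ∷ xs) with P? x
... | yes _ = cong (f x +_) (sumMap-filter P? f xs)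
... | no _  = trans (sumMap-filter P? f xs) (sym (ℚP.+-identityˡ _))

sumMap-map : (f : B → ℚ) (g : A → B) (xs : List A) → sumMap f (map g xs) ≡ sumMap (f ∘ g) xs
sumMap-map f g xs = cong (foldr _+_ 0ℚ) (sym (ListP.map-∘ xs))

sumMap-concatMap : (f : B → ℚ) (g : A → List B) (xs : List A) →
                   sumMap f (concatMap g xs) ≡ sumMap (sumMap f ∘ g) xs
sumMap-concatMap f g []       = refl
sumMap-concatMap f g (x ∷ xs) = begin
  sumMap f (g x ++ concatMap g xs)           ≡⟨ sumMap-++ f (g x) (concatMap g xs) ⟩
  sumMap f (g x) + sumMap f (concatMap g xs) ≡⟨ cong (sumMap f (g x) +_) (sumMap-concatMap f g xs) ⟩
  sumMap f (g x) + sumMap (sumMap f ∘ g) xs  ∎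

sumMap-when-*ˡ : {P : Set} (d : Dec P) (c : ℚ) (f : A → ℚ) (xs : List A) →
                 sumMap (λ x → when d (c * f x)) xs ≡ when d (c * sumMap f xs)
sumMap-when-*ˡ d c f xs = begin
  sumMap (λ x → when d (c * f x)) xs ≡⟨ sumMap-cong (λ x → sym (when-* d c (f x))) xs ⟩
  sumMap (λ x → when d c * f x) xs   ≡⟨ sumMap-*ˡ (when d c) f xs ⟩
  when d c * sumMap f xs             ≡⟨ when-* d c _ ⟩
  when d (c * sumMap f xs)           ∎

-- Opaque so that the summand of ∑ n f is inferred by unification rather than lost in its unfolding.
opaque
  ∑ : ℕ → (ℕ → ℚ) → ℚ
  ∑ n f = Fin∑.sum (f ∘ toℕ {n})

  ∑-suc : ∀ n (f : ℕ → ℚ) → ∑ (suc n) f ≡ f 0 + ∑ n (f ∘ suc)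
  ∑-suc n f = refl

  sumMap-applyUpTo : (f : ℕ → ℚ) (g : ℕ → ℕ) (n : ℕ) → sumMap f (applyUpTo g n) ≡ ∑ n (f ∘ g)
  sumMap-applyUpTo f g zero    = refl
  sumMap-applyUpTo f g (suc n) = cong (f (g 0) +_) (sumMap-applyUpTo f (g ∘ suc) n)

  ∑-cong< : ∀ n {f g : ℕ → ℚ} → (∀ i → i < n → f i ≡ g i) → ∑ n f ≡ ∑ n g
  ∑-cong< n f≗g = Fin∑.sum-cong-≗ {n} (λ i → f≗g (toℕ i) (toℕ<n i))

  ∑-zero< : ∀ n {f : ℕ → ℚ} → (∀ i → i < n → f i ≡ 0ℚ) → ∑ n f ≡ 0ℚ
  ∑-zero< n f≗0 = trans (∑-cong< n {g = λ _ → 0ℚ} f≗0) (Fin∑.sum-replicate-zero n)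

  *-distribˡ-∑ : ∀ n (c : ℚ) (f : ℕ → ℚ) → c * ∑ n f ≡ ∑ n (λ i → c * f i)
  *-distribˡ-∑ n c f = Fin∑.*-distribˡ-sum c (f ∘ toℕ {n})

  ∑-swap : ∀ m n (f : ℕ → ℕ → ℚ) → ∑ m (λ i → ∑ n (f i)) ≡ ∑ n (λ j → ∑ m (λ i → f i j))
  ∑-swap m n f = Fin∑.∑-comm {m} {n} (λ i j → f (toℕ i) (toℕ j))

  ∑-truncate : ∀ {n N} {f : ℕ → ℚ} → n ≤ N → (∀ i → n ≤ i → i < N → f i ≡ 0ℚ) → ∑ N f ≡ ∑ n f
  ∑-truncate {zero}  {N}         _         f≗0 = ∑-zero< N (λ i → f≗0 i z≤n)
  ∑-truncate {suc n} {suc N} {f} (s≤s n≤N) f≗0 =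
    cong (f 0 +_) (∑-truncate n≤N (λ i n≤i i<N → f≗0 (suc i) (s≤s n≤i) (s≤s i<N)))

  ∑-single : ∀ {n} {f : ℕ → ℚ} j → j < n → (∀ i → i < n → i ≢ j → f i ≡ 0ℚ) → ∑ n f ≡ f j
  ∑-single {suc n} {f} zero    _ f≗0 =
    trans (cong (f 0 +_) (∑-zero< n (λ i i<n → f≗0 (suc i) (s≤s i<n) (λ ())))) (ℚP.+-identityʳ _)
  ∑-single {suc n} {f} (suc j) (s≤s j<n) f≗0 = begin
    f 0 + ∑ n (f ∘ suc) ≡⟨ cong (_+ ∑ n (f ∘ suc)) (f≗0 0 (s≤s z≤n) (λ ())) ⟩
    0ℚ + ∑ n (f ∘ suc)  ≡⟨ ℚP.+-identityˡ _ ⟩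
    ∑ n (f ∘ suc)       ≡⟨ ∑-single j j<n (λ i i<n i≢j → f≗0 (suc i) (s≤s i<n) (i≢j ∘ ℕP.suc-injective)) ⟩
    f (suc j)           ∎

sumMap-upTo : (n : ℕ) (f : ℕ → ℚ) → sumMap f (upTo n) ≡ ∑ n f
sumMap-upTo n f = sumMap-applyUpTo f id n

sumMap-concatMap-upTo : (f : B → ℚ) (g : ℕ → List B) (n : ℕ) →
                        sumMap f (concatMap g (upTo n)) ≡ ∑ n (sumMap f ∘ g)
sumMap-concatMap-upTo f g n = trans (sumMap-concatMap f g (upTo n)) (sumMap-upTo n _)

∑-cong : ∀ n {f g : ℕ → ℚ} → (∀ i → f i ≡ g i) → ∑ n f ≡ ∑ n g
∑-cong n f≗g = ∑-cong< n (λ i _ → f≗g i)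

∑-when : ∀ n {P : Set} (d : Dec P) (f : ℕ → ℚ) → ∑ n (λ i → when d (f i)) ≡ when d (∑ n f)
∑-when n (yes _) f = refl
∑-when n (no _)  f = ∑-zero< n (λ _ _ → refl)

∑-when-≟ : (k j : ℕ) (f : ℕ → ℚ) → ∑ (suc k) (λ a → when (j ≟ a) (f a)) ≡ when (j ≤? k) (f j)
∑-when-≟ k j f with j ≤? k
... | yes j≤k = trans (∑-single j (s≤s j≤k) (λ a _ a≢j → when-no (j ≟ a) {f a} (a≢j ∘ sym))) (when-yes (j ≟ j) refl)
... | no  j≰k = ∑-zero< (suc k) (λ { a (s≤s a≤k) → when-no (j ≟ a) {f a} (λ { refl → j≰k a≤k }) })

⊛≡∑ : (f g : PS) (k n : ℕ) → (f ⊛ g) k n ≡ ∑ (suc k) λ a → ∑ (suc n) λ c → f a c * g (k ∸ a) (n ∸ c)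
⊛≡∑ f g k n = trans (sumMap-upTo (suc k) _) (∑-cong (suc k) λ a → sumMap-upTo (suc n) _)

xPS-constant : ∀ a → xPS a 0 ≡ 0ℚ
xPS-constant zero    = refl
xPS-constant (suc a) = refl

xPS⊛-zero : (H : PS) (k : ℕ) → (xPS ⊛ H) k 0 ≡ 0ℚ
xPS⊛-zero H k = trans (⊛≡∑ xPS H k 0) (∑-zero< (suc k) λ a _ → ∑-zero< 1 λ
  { zero _ → trans (cong (_* H (k ∸ a) 0) (xPS-constant a)) (ℚP.*-zeroˡ (H (k ∸ a) 0))
  ; (suc _) (s≤s ()) })

xPS⊛-suc : (H : PS) (k n : ℕ) → (xPS ⊛ H) k (suc n) ≡ H k n
xPS⊛-suc H k n = begin
  (xPS ⊛ H) k (suc n)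
    ≡⟨ ⊛≡∑ xPS H k (suc n) ⟩
  ∑ (suc k) (λ a → ∑ (suc (suc n)) λ c → xPS a c * H (k ∸ a) (suc n ∸ c))
    ≡⟨ ∑-single 0 (s≤s z≤n) (λ
         { zero    _ 0≢0 → ⊥-elim (0≢0 refl)
         ; (suc a) _ _   → ∑-zero< (suc (suc n)) (λ c _ → ℚP.*-zeroˡ (H (k ∸ suc a) (suc n ∸ c))) }) ⟩
  ∑ (suc (suc n)) (λ c → xPS 0 c * H k (suc n ∸ c))
    ≡⟨ ∑-single 1 (s≤s (s≤s z≤n)) (λ
         { zero          _ _   → ℚP.*-zeroˡ (H k (suc n))
         ; (suc zero)    _ 1≢1 → ⊥-elim (1≢1 refl)
         ; (suc (suc c)) _ _   → ℚP.*-zeroˡ (H k (n ∸ suc c)) }) ⟩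
  1ℚ * H k n ≡⟨ ℚP.*-identityˡ _ ⟩
  H k n      ∎

uPow-∸ : ∀ j a {c c′} → c′ < c → uPow j a (c ∸ c′) ≡ 0ℚ
uPow-∸ j a {suc c} {zero}   _          = refl
uPow-∸ j a {suc c} {suc c′} (s≤s c′<c) = uPow-∸ j a c′<c

*-uPow-constant : (x : ℚ) (j a : ℕ) → x * uPow j a 0 ≡ when (j ≟ a) x
*-uPow-constant x j a with j ≟ a
... | yes _ = ℚP.*-identityʳ x
... | no _  = ℚP.*-zeroʳ x

polyPS⊛uPow : (q : Poly) (j a c : ℕ) → (polyPS q ⊛ uPow j) a c ≡ when (j ≟ a) (coeff q c)
polyPS⊛uPow q j a c = begin
  (polyPS q ⊛ uPow j) a c
    ≡⟨ ⊛≡∑ (polyPS q) (uPow j) a c ⟩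
  ∑ (suc a) (λ a′ → ∑ (suc c) λ c′ → polyPS q a′ c′ * uPow j (a ∸ a′) (c ∸ c′))
    ≡⟨ ∑-single 0 (s≤s z≤n) (λ
         { zero     _ 0≢0 → ⊥-elim (0≢0 refl)
         ; (suc a′) _ _   → ∑-zero< (suc c) (λ c′ _ → ℚP.*-zeroˡ (uPow j (a ∸ suc a′) (c ∸ c′))) }) ⟩
  ∑ (suc c) (λ c′ → coeff q c′ * uPow j a (c ∸ c′))
    ≡⟨ ∑-single c ℕP.≤-refl (λ c′ c′≤c c′≢c →
         trans (cong (coeff q c′ *_) (uPow-∸ j a (ℕP.≤∧≢⇒< (ℕP.≤-pred c′≤c) c′≢c))) (ℚP.*-zeroʳ (coeff q c′))) ⟩
  coeff q c * uPow j a (c ∸ c) ≡⟨ cong (λ d → coeff q c * uPow j a d) (ℕP.n∸n≡0 c) ⟩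
  coeff q c * uPow j a 0       ≡⟨ *-uPow-constant (coeff q c) j a ⟩
  when (j ≟ a) (coeff q c)     ∎

polyPS⊛uPow⊛ : (q : Poly) (j : ℕ) (H : PS) (k n : ℕ) →
               ((polyPS q ⊛ uPow j) ⊛ H) k n ≡
               when (j ≤? k) (∑ (suc n) λ c → coeff q c * H (k ∸ j) (n ∸ c))
polyPS⊛uPow⊛ q j H k n = begin
  ((polyPS q ⊛ uPow j) ⊛ H) k n
    ≡⟨ ⊛≡∑ (polyPS q ⊛ uPow j) H k n ⟩
  ∑ (suc k) (λ a → ∑ (suc n) λ c → (polyPS q ⊛ uPow j) a c * H (k ∸ a) (n ∸ c))
    ≡⟨ ∑-cong (suc k) (λ a → trans
         (∑-cong (suc n) λ c → trans (cong (_* H (k ∸ a) (n ∸ c)) (polyPS⊛uPow q j a c)) (when-* (j ≟ a) _ _))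
         (∑-when (suc n) (j ≟ a) _)) ⟩
  ∑ (suc k) (λ a → when (j ≟ a) (∑ (suc n) λ c → coeff q c * H (k ∸ a) (n ∸ c)))
    ≡⟨ ∑-when-≟ k j _ ⟩
  when (j ≤? k) (∑ (suc n) λ c → coeff q c * H (k ∸ j) (n ∸ c)) ∎

∸-suc-< : ∀ {r n} → r < n → n ∸ suc r < n
∸-suc-< {r} {suc n} _ = s≤s (ℕP.m∸n≤m n r)

module _ (L J : ℕ) (Q : ℕ → ℕ → Poly) where

  -- Prepend to the paths counted by G a step (1 + r, ℓ - j) of weight [x^r] Q ℓ j, allowed at height k iff j ≤ k.
  firstStep : PS → PS
  firstStep G k n = ∑ (suc L) λ ℓ → ∑ (suc J) λ j →
    when (j ≤? k) (∑ n λ r → coeff (Q ℓ j) r * G (k ∸ j ℕ.+ ℓ) (n ∸ suc r))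

  firstStep-local : ∀ {G H} k n → (∀ k′ m → m < n → G k′ m ≡ H k′ m) → firstStep G k n ≡ firstStep H k n
  firstStep-local k n G≗H = ∑-cong (suc L) λ ℓ → ∑-cong (suc J) λ j → cong (when (j ≤? k)) (∑-cong< n λ r r<n →
    cong (coeff (Q ℓ j) r *_) (G≗H _ _ (∸-suc-< r<n)))

  firstStep-vanishes : ∀ {G} k n → (∀ k′ m → m < n → G k′ m ≡ 0ℚ) → firstStep G k n ≡ 0ℚ
  firstStep-vanishes k n G≗0 = ∑-zero< (suc L) λ ℓ _ → ∑-zero< (suc J) λ j _ →
    trans (cong (when (j ≤? k)) (∑-zero< n λ r r<n →
             trans (cong (coeff (Q ℓ j) r *_) (G≗0 _ _ (∸-suc-< r<n))) (ℚP.*-zeroʳ (coeff (Q ℓ j) r))))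
          (when-0 (j ≤? k))

  firstStep-∑ : ∀ N (G : ℕ → PS) k n →
                firstStep (λ k′ n′ → ∑ N λ m → G m k′ n′) k n ≡ ∑ N λ m → firstStep (G m) k n
  firstStep-∑ N G k n = begin
    (∑ (suc L) λ ℓ → ∑ (suc J) λ j → when (j ≤? k) (∑ n λ r → q ℓ j r * ∑ N λ m → G m (k′ ℓ j) (n ∸ suc r)))
      ≡⟨ ∑-cong (suc L) (λ ℓ → ∑-cong (suc J) λ j → begin
           when (j ≤? k) (∑ n λ r → q ℓ j r * ∑ N λ m → G m (k′ ℓ j) (n ∸ suc r))
             ≡⟨ cong (when (j ≤? k)) (∑-cong n λ r → *-distribˡ-∑ N (q ℓ j r) _) ⟩
           when (j ≤? k) (∑ n λ r → ∑ N λ m → q ℓ j r * G m (k′ ℓ j) (n ∸ suc r))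
             ≡⟨ cong (when (j ≤? k)) (∑-swap n N _) ⟩
           when (j ≤? k) (∑ N λ m → term m ℓ j)
             ≡⟨ sym (∑-when N (j ≤? k) _) ⟩
           (∑ N λ m → when (j ≤? k) (term m ℓ j)) ∎) ⟩
    (∑ (suc L) λ ℓ → ∑ (suc J) λ j → ∑ N λ m → when (j ≤? k) (term m ℓ j))
      ≡⟨ ∑-cong (suc L) (λ ℓ → ∑-swap (suc J) N _) ⟩
    (∑ (suc L) λ ℓ → ∑ N λ m → ∑ (suc J) λ j → when (j ≤? k) (term m ℓ j))
      ≡⟨ ∑-swap (suc L) N _ ⟩
    (∑ N λ m → firstStep (G m) k n) ∎
    where
    q : ℕ → ℕ → ℕ → ℚ
    q ℓ j r = coeff (Q ℓ j) r
    k′ : ℕ → ℕ → ℕ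
    k′ ℓ j = k ∸ j ℕ.+ ℓ
    term : ℕ → ℕ → ℕ → ℚ
    term m ℓ j = ∑ n λ r → q ℓ j r * G m (k′ ℓ j) (n ∸ suc r)

  RHS≡1+firstStep : (G : PS) (k n : ℕ) → RHS L J Q G k n ≡ onePS k n + firstStep G k n
  RHS≡1+firstStep G k n = cong (onePS k n +_) (x⊛kernel n)
    where
    kernel : PS
    kernel = ΣPS (suc L) (λ ℓ → ΣPS (suc J) (λ j → (polyPS (Q ℓ j) ⊛ uPow j) ⊛ Δ^ ℓ G))
    x⊛kernel : ∀ n → (xPS ⊛ kernel) k n ≡ firstStep G k n
    x⊛kernel zero    = trans (xPS⊛-zero kernel k) (sym (firstStep-vanishes {G} k 0 (λ _ _ ())))
    x⊛kernel (suc n) =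
      trans (xPS⊛-suc kernel k n)
      (trans (sumMap-upTo (suc L) _) (∑-cong (suc L) λ ℓ →
       trans (sumMap-upTo (suc J) _) (∑-cong (suc J) λ j →
       polyPS⊛uPow⊛ (Q ℓ j) j (Δ^ ℓ G) k n)))

  Step : ℕ → ℕ → ℕ → ℕ → ℕ → Set
  Step k n ℓ j r = ℓ ≤ L × j ≤ k × j ≤ J × coeff (Q ℓ j) r ≢ 0ℚ × r < n

  step? : ∀ k n ℓ j r → Dec (Step k n ℓ j r)
  step? k n ℓ j r = ℓ ≤? L ×-dec j ≤? k ×-dec j ≤? J ×-dec ¬? (coeff (Q ℓ j) r ℚP.≟ 0ℚ) ×-dec r <? n

  when-step : ∀ {k n ℓ j r} → ℓ ≤ L → j ≤ J → r < n → (x : ℚ) →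
              when (step? k n ℓ j r) (coeff (Q ℓ j) r * x) ≡ when (j ≤? k) (coeff (Q ℓ j) r * x)
  when-step {k} {n} {ℓ} {j} {r} ℓ≤L j≤J r<n x = by-qᵣ≟0 (coeff (Q ℓ j) r ℚP.≟ 0ℚ)
    where
    vanish : {P : Set} (d : Dec P) → coeff (Q ℓ j) r ≡ 0ℚ → when d (coeff (Q ℓ j) r * x) ≡ 0ℚ
    vanish d qᵣ≡0 = trans (when-cong d λ _ → trans (cong (_* x) qᵣ≡0) (ℚP.*-zeroˡ x)) (when-0 d)
    by-qᵣ≟0 : Dec (coeff (Q ℓ j) r ≡ 0ℚ) →
              when (step? k n ℓ j r) (coeff (Q ℓ j) r * x) ≡ when (j ≤? k) (coeff (Q ℓ j) r * x)
    by-qᵣ≟0 (yes qᵣ≡0) = trans (vanish (step? k n ℓ j r) qᵣ≡0) (sym (vanish (j ≤? k) qᵣ≡0))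
    by-qᵣ≟0 (no qᵣ≢0)  = when-⇔ (step? k n ℓ j r) (j ≤? k) (proj₁ ∘ proj₂) (λ j≤k → ℓ≤L , j≤k , j≤J , qᵣ≢0 , r<n)

  firstStep≡∑step : ∀ G k n → firstStep G k n ≡
    (∑ (suc L) λ ℓ → ∑ (suc J) λ j → ∑ n λ r → when (step? k n ℓ j r) (coeff (Q ℓ j) r * G (k ∸ j ℕ.+ ℓ) (n ∸ suc r)))
  firstStep≡∑step G k n = ∑-cong< (suc L) λ ℓ ℓ<1+L → ∑-cong< (suc J) λ j j<1+J →
    trans (sym (∑-when n (j ≤? k) _)) (∑-cong< n λ r r<n →
      sym (when-step (ℕP.≤-pred ℓ<1+L) (ℕP.≤-pred j<1+J) r<n (G (k ∸ j ℕ.+ ℓ) (n ∸ suc r))))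

  Allowed-∷⁻ : ∀ {k ℓ j r p n b} → Allowed L J Q k ((ℓ , j , r) ∷ p) n b →
               Step k n ℓ j r × Allowed L J Q (k ∸ j ℕ.+ ℓ) p (n ∸ suc r) b
  Allowed-∷⁻ {k} {ℓ} {j} {r} {p} {b = b} (step {m = m} ℓ≤L j≤k j≤J qᵣ≢0 refl rest) =
    (ℓ≤L , j≤k , j≤J , qᵣ≢0 , s≤s (ℕP.m≤m+n r m)) ,
    subst (λ n′ → Allowed L J Q (k ∸ j ℕ.+ ℓ) p n′ b) (sym (ℕP.m+n∸m≡n r m)) rest

  Allowed-∷⁺ : ∀ {k ℓ j r p n b} → Step k n ℓ j r → Allowed L J Q (k ∸ j ℕ.+ ℓ) p (n ∸ suc r) b →
               Allowed L J Q k ((ℓ , j , r) ∷ p) n b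
  Allowed-∷⁺ (ℓ≤L , j≤k , j≤J , qᵣ≢0 , r<n) rest = step ℓ≤L j≤k j≤J qᵣ≢0 (sym (ℕP.m+[n∸m]≡n r<n)) rest

  pathWeight : ℕ → ℕ → List Triple → ℚ
  pathWeight k n p = when (allowed? L J Q k p n 0) (weight Q p)

  pathWeight-[] : ∀ k n → pathWeight k n [] ≡ onePS k n
  pathWeight-[] zero    zero    = when-yes (allowed? L J Q 0 [] 0 0) {1ℚ} (stop refl refl)
  pathWeight-[] zero    (suc n) = when-no (allowed? L J Q 0 [] (suc n) 0) {1ℚ} λ { (stop () _) }
  pathWeight-[] (suc k) n       = when-no (allowed? L J Q (suc k) [] n 0) {1ℚ} λ { (stop _ ()) }

  pathWeight-∷ : ∀ k n ℓ j r p → pathWeight k n ((ℓ , j , r) ∷ p) ≡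
                 when (step? k n ℓ j r) (coeff (Q ℓ j) r * pathWeight (k ∸ j ℕ.+ ℓ) (n ∸ suc r) p)
  pathWeight-∷ k n ℓ j r p =
    trans (when-⇔ (allowed? L J Q k ((ℓ , j , r) ∷ p) n 0) (step? k n ℓ j r ×-dec rest?)
                  Allowed-∷⁻ (uncurry Allowed-∷⁺))
          (when-× (step? k n ℓ j r) rest? (coeff (Q ℓ j) r) (weight Q p))
    where
    rest? = allowed? L J Q (k ∸ j ℕ.+ ℓ) p (n ∸ suc r) 0

  walks : ℕ → PS
  walks zero    = onePS
  walks (suc m) = firstStep (walks m)

  walks-vanish : ∀ m k n → n < m → walks m k n ≡ 0ℚ
  walks-vanish (suc m) k n (s≤s n≤m) =
    firstStep-vanishes k n (λ k′ n′ n′<n → walks-vanish m k′ n′ (ℕP.<-≤-trans n′<n n≤m))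

  sumMap-triples : ∀ R (h : Triple → ℚ) →
                   sumMap h (triples L J R) ≡ ∑ (suc L) λ ℓ → ∑ (suc J) λ j → ∑ R λ r → h (ℓ , j , r)
  sumMap-triples R h =
    trans (sumMap-concatMap-upTo h (λ ℓ → concatMap (λ j → map (λ r → ℓ , j , r) (upTo R)) (upTo (suc J))) (suc L))
    (∑-cong (suc L) λ ℓ → trans (sumMap-concatMap-upTo h (λ j → map (λ r → ℓ , j , r) (upTo R)) (suc J))
    (∑-cong (suc J) λ j → trans (sumMap-map h (λ r → ℓ , j , r) (upTo R)) (sumMap-upTo R _)))

  sumMap-seqs : ∀ m k n R → n ≤ R → sumMap (pathWeight k n) (seqs m (triples L J R)) ≡ walks m k n
  sumMap-seqs zero    k n R _   = trans (ℚP.+-identityʳ _) (pathWeight-[] k n)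
  sumMap-seqs (suc m) k n R n≤R = begin
    sumMap (pathWeight k n) (seqs (suc m) T)
      ≡⟨ sumMap-concatMap (pathWeight k n) (λ t → map (t ∷_) (seqs m T)) T ⟩
    sumMap (λ t → sumMap (pathWeight k n) (map (t ∷_) (seqs m T))) T
      ≡⟨ sumMap-triples R _ ⟩
    (∑ (suc L) λ ℓ → ∑ (suc J) λ j → ∑ R λ r → sumMap (pathWeight k n) (map ((ℓ , j , r) ∷_) (seqs m T)))
      ≡⟨ ∑-cong (suc L) (λ ℓ → ∑-cong (suc J) λ j → ∑-cong R λ r → prepend ℓ j r) ⟩
    (∑ (suc L) λ ℓ → ∑ (suc J) λ j → ∑ R λ r → stepTerm ℓ j r)
      ≡⟨ ∑-cong (suc L) (λ ℓ → ∑-cong (suc J) λ j → ∑-truncate n≤R λ r n≤r _ →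
           when-no (step? k n ℓ j r) λ (_ , _ , _ , _ , r<n) → ℕP.<⇒≱ r<n n≤r) ⟩
    (∑ (suc L) λ ℓ → ∑ (suc J) λ j → ∑ n λ r → stepTerm ℓ j r)
      ≡⟨ sym (firstStep≡∑step (walks m) k n) ⟩
    walks (suc m) k n ∎
    where
    T = triples L J R
    stepTerm : ℕ → ℕ → ℕ → ℚ
    stepTerm ℓ j r = when (step? k n ℓ j r) (coeff (Q ℓ j) r * walks m (k ∸ j ℕ.+ ℓ) (n ∸ suc r))
    prepend : ∀ ℓ j r → sumMap (pathWeight k n) (map ((ℓ , j , r) ∷_) (seqs m T)) ≡ stepTerm ℓ j r
    prepend ℓ j r = begin
      sumMap (pathWeight k n) (map ((ℓ , j , r) ∷_) (seqs m T))
        ≡⟨ sumMap-map (pathWeight k n) ((ℓ , j , r) ∷_) (seqs m T) ⟩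
      sumMap (pathWeight k n ∘ ((ℓ , j , r) ∷_)) (seqs m T)
        ≡⟨ sumMap-cong (pathWeight-∷ k n ℓ j r) (seqs m T) ⟩
      sumMap (λ p → when (step? k n ℓ j r) (coeff (Q ℓ j) r * pathWeight k′ n′ p)) (seqs m T)
        ≡⟨ sumMap-when-*ˡ (step? k n ℓ j r) (coeff (Q ℓ j) r) (pathWeight k′ n′) (seqs m T) ⟩
      when (step? k n ℓ j r) (coeff (Q ℓ j) r * sumMap (pathWeight k′ n′) (seqs m T))
        ≡⟨ cong (λ x → when (step? k n ℓ j r) (coeff (Q ℓ j) r * x))
                (sumMap-seqs m k′ n′ R (ℕP.≤-trans (ℕP.m∸n≤m n (suc r)) n≤R)) ⟩
      stepTerm ℓ j r ∎
      where
      k′ = k ∸ j ℕ.+ ℓ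
      n′ = n ∸ suc r

  pathSum : PS
  pathSum k n = ∑ (suc n) λ m → walks m k n

  F≡pathSum : ∀ k n → F L J Q k n ≡ pathSum k n
  F≡pathSum k n = begin
    F L J Q k n
      ≡⟨ sumMap-filter (λ p → allowed? L J Q k p n 0) (weight Q) (candidates L J n) ⟩
    sumMap (pathWeight k n) (candidates L J n)
      ≡⟨ sumMap-concatMap-upTo (pathWeight k n) (λ m → seqs m (triples L J n)) (suc n) ⟩
    (∑ (suc n) λ m → sumMap (pathWeight k n) (seqs m (triples L J n)))
      ≡⟨ ∑-cong (suc n) (λ m → sumMap-seqs m k n n ℕP.≤-refl) ⟩
    pathSum k n ∎

  pathSum-firstStep : ∀ k n → pathSum k n ≡ onePS k n + firstStep pathSum k n
  pathSum-firstStep k n = begin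
    pathSum k n
      ≡⟨ ∑-suc n _ ⟩
    onePS k n + (∑ n λ m → firstStep (walks m) k n)
      ≡⟨ cong (onePS k n +_) (sym (firstStep-∑ n walks k n)) ⟩
    onePS k n + firstStep (λ k′ n′ → ∑ n λ m → walks m k′ n′) k n
      ≡⟨ cong (onePS k n +_) (firstStep-local k n λ k′ n′ n′<n →
           ∑-truncate n′<n (λ m n′<m _ → walks-vanish m k′ n′ n′<m)) ⟩
    onePS k n + firstStep pathSum k n ∎

  F-solves : Solves L J Q (F L J Q)
  F-solves k n = begin
    F L J Q k n                         ≡⟨ F≡pathSum k n ⟩
    pathSum k n                         ≡⟨ pathSum-firstStep k n ⟩
    onePS k n + firstStep pathSum k n   ≡⟨ cong (onePS k n +_) (firstStep-local k n λ k′ m _ → sym (F≡pathSum k′ m)) ⟩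
    onePS k n + firstStep (F L J Q) k n ≡⟨ sym (RHS≡1+firstStep (F L J Q) k n) ⟩
    RHS L J Q (F L J Q) k n             ∎

  solutions-unique : ∀ {G H} → Solves L J Q G → Solves L J Q H → ∀ k n → G k n ≡ H k n
  solutions-unique {G} {H} G-solves H-solves k n = <-rec (λ n → ∀ k → G k n ≡ H k n) agree n k
    where
    agree : ∀ n → (∀ {m} → m < n → ∀ k → G k m ≡ H k m) → ∀ k → G k n ≡ H k n
    agree n G≡H-below k = begin
      G k n                       ≡⟨ G-solves k n ⟩
      RHS L J Q G k n             ≡⟨ RHS≡1+firstStep G k n ⟩
      onePS k n + firstStep G k n ≡⟨ cong (onePS k n +_) (firstStep-local k n λ k′ m m<n → G≡H-below m<n k′) ⟩
      onePS k n + firstStep H k n ≡⟨ sym (RHS≡1+firstStep H k n) ⟩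
      RHS L J Q H k n             ≡⟨ sym (H-solves k n) ⟩
      H k n                       ∎

-- Neither 1 ≤ L nor the nonnegativity of the coefficients is needed.
lemma1 : (L J : ℕ) → 1 ≤ L → (Q : ℕ → ℕ → Poly) →
    (∀ ℓ j → ℓ ≤ L → j ≤ J → All (0ℚ ≤ℚ_) (Q ℓ j)) →
    Solves L J Q (F L J Q) ×
    (∀ (G : PS) → Solves L J Q G → ∀ k n → G k n ≡ F L J Q k n)
lemma1 L J _ Q _ = F-solves L J Q , λ G G-solves → solutions-unique L J Q G-solves (F-solves L J Q)
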